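{- Let $n,k$ be positive integers, where $n$ is even and $k<n/2$. Then the double generalized Petersen graph $\mathrm{DP}(n,k)$ is isomorphic to $\mathrm{DP}(n,n/2-k)$.
   Context: For integers $n\ge 3$ and $1\le k<n/2$, the double generalized Petersen graph $\mathrm{DP}(n,k)$ has vertex set $\{u_i,w_i,x_i,y_i : i=0,\dots,n-1\}$ and edge set consisting of the edges $u_iu_{i+1}$, $x_ix_{i+1}$, $w_iy_{i+k}$, $y_iw_{i+k}$, $u_iw_i$ and $x_iy_i$, for $i=0,\dots,n-1$, with subscripts taken modulo $n$. -}

module Defs where

open import Data.Nat using (ℕ; _+_; _%_; NonZero)
open import Data.Fin using (Fin; toℕ; fromℕ<)
open import Data.Nat.DivMod using (m%n<n)
open import Data.Product using (_×_; _,_)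
open import Data.Sum using (_⊎_)
open import Function.Bundles using (_⤖_; _⇔_; Bijection)
open import Relation.Binary.PropositionalEquality using (_≡_)

_⊕_ : ∀ {n} .{{_ : NonZero n}} → Fin n → ℕ → Fin n
_⊕_ {n} i k = fromℕ< (m%n<n (toℕ i + k) n)

data Kind : Set where
  U W X Y : Kind

Vertex : ℕ → Set
Vertex n = Kind × Fin n

data Edge (n k : ℕ) .{{_ : NonZero n}} : Vertex n → Vertex n → Set where
  uu : ∀ i → Edge n k (U , i) (U , i ⊕ 1)
  xx : ∀ i → Edge n k (X , i) (X , i ⊕ 1)
  wy : ∀ i → Edge n k (W , i) (Y , i ⊕ k)
  yw : ∀ i → Edge n k (Y , i) (W , i ⊕ k)
  uw : ∀ i → Edge n k (U , i) (W , i)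
  xy : ∀ i → Edge n k (X , i) (Y , i)

Adj : (n k : ℕ) .{{_ : NonZero n}} → Vertex n → Vertex n → Set
Adj n k a b = Edge n k a b ⊎ Edge n k b a

record DPIso (n k k' : ℕ) .{{_ : NonZero n}} : Set where
  field
    φ : Vertex n ⤖ Vertex n
    preserves : ∀ a b →
      Adj n k a b ⇔ Adj n k' (Bijection.to φ a) (Bijection.to φ b)

-- Rotating the x- and y-layers of DP(n,k) by half a turn, i ↦ i + n/2, while fixing the
-- u- and w-layers, keeps the rims and spokes and turns every inner edge w_i y_{i+k} into
-- y_{i+k+n/2} w_i, an edge of step n/2 - k since (i + k + n/2) + (n/2 - k) ≡ i mod n.
-- The rotation is an involution, so the same map is also the inverse isomorphism.
module Submission where

open import Defs
open import Data.Nat using (ℕ; _+_; _*_; _∸_; _%_; _<_; _≤_; NonZero)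
open import Data.Nat.Divisibility using (_∣_; divides-refl)
open import Data.Nat.DivMod using (_/_; %-distribˡ-+; m%n%n≡m%n; [m+n]%n≡m%n; m<n⇒m%n≡m; m%n<n; m*n/n≡m)
open import Data.Nat.Properties using (+-assoc; +-comm; +-identityʳ; *-comm; m+[n∸m]≡n; *-cancelˡ-<; <⇒≤)
open import Data.Fin using (Fin; toℕ)
open import Data.Fin.Properties using (toℕ-injective; toℕ-fromℕ<; toℕ<n)
open import Data.Product using (_,_)
open import Data.Sum using (inj₁; inj₂; swap)
open import Function.Bundles using (mk↔ₛ′; mk⇔)
open import Function.Properties.Inverse using (↔⇒⤖)
open import Relation.Binary.PropositionalEquality

module _ {n : ℕ} .{{_ : NonZero n}} where

  toℕ-⊕ : (i : Fin n) (a : ℕ) → toℕ (i ⊕ a) ≡ (toℕ i + a) % n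
  toℕ-⊕ i a = toℕ-fromℕ< (m%n<n (toℕ i + a) n)

  ⊕-assoc : (i : Fin n) (a b : ℕ) → (i ⊕ a) ⊕ b ≡ i ⊕ (a + b)
  ⊕-assoc i a b = toℕ-injective (begin
      toℕ ((i ⊕ a) ⊕ b)             ≡⟨ toℕ-⊕ (i ⊕ a) b ⟩
      (toℕ (i ⊕ a) + b) % n         ≡⟨ cong (λ v → (v + b) % n) (toℕ-⊕ i a) ⟩
      ((x + a) % n + b) % n         ≡⟨ %-distribˡ-+ ((x + a) % n) b n ⟩
      ((x + a) % n % n + b % n) % n ≡⟨ cong (λ v → (v + b % n) % n) (m%n%n≡m%n (x + a) n) ⟩
      ((x + a) % n + b % n) % n     ≡⟨ %-distribˡ-+ (x + a) b n ⟨
      (x + a + b) % n               ≡⟨ cong (_% n) (+-assoc x a b) ⟩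
      (x + (a + b)) % n             ≡⟨ toℕ-⊕ i (a + b) ⟨
      toℕ (i ⊕ (a + b))             ∎)
    where
    open ≡-Reasoning
    x = toℕ i

  ⊕-comm : (i : Fin n) (a b : ℕ) → (i ⊕ a) ⊕ b ≡ (i ⊕ b) ⊕ a
  ⊕-comm i a b = begin
    (i ⊕ a) ⊕ b ≡⟨ ⊕-assoc i a b ⟩
    i ⊕ (a + b) ≡⟨ cong (i ⊕_) (+-comm a b) ⟩
    i ⊕ (b + a) ≡⟨ ⊕-assoc i b a ⟨
    (i ⊕ b) ⊕ a ∎
    where open ≡-Reasoning

  i⊕n≡i : (i : Fin n) → i ⊕ n ≡ i
  i⊕n≡i i = toℕ-injective (begin
    toℕ (i ⊕ n)      ≡⟨ toℕ-⊕ i n ⟩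
    (toℕ i + n) % n  ≡⟨ [m+n]%n≡m%n (toℕ i) n ⟩
    toℕ i % n        ≡⟨ m<n⇒m%n≡m (toℕ<n i) ⟩
    toℕ i            ∎)
    where open ≡-Reasoning

module HalfTurn {n : ℕ} .{{_ : NonZero n}} (m k k' : ℕ) (n≡m+m : n ≡ m + m) (k+k'≡m : k + k' ≡ m) where

  halfTurn : Vertex n → Vertex n
  halfTurn (U , i) = U , i
  halfTurn (W , i) = W , i
  halfTurn (X , i) = X , i ⊕ m
  halfTurn (Y , i) = Y , i ⊕ m

  ⊕m⊕m≡id : (i : Fin n) → (i ⊕ m) ⊕ m ≡ i
  ⊕m⊕m≡id i = begin
    (i ⊕ m) ⊕ m ≡⟨ ⊕-assoc i m m ⟩
    i ⊕ (m + m) ≡⟨ cong (i ⊕_) n≡m+m ⟨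
    i ⊕ n       ≡⟨ i⊕n≡i i ⟩
    i           ∎
    where open ≡-Reasoning

  halfTurn-involutive : ∀ a → halfTurn (halfTurn a) ≡ a
  halfTurn-involutive (U , i) = refl
  halfTurn-involutive (W , i) = refl
  halfTurn-involutive (X , i) = cong (X ,_) (⊕m⊕m≡id i)
  halfTurn-involutive (Y , i) = cong (Y ,_) (⊕m⊕m≡id i)

  ⊕k⊕k'≡⊕m : (i : Fin n) → (i ⊕ k) ⊕ k' ≡ i ⊕ m
  ⊕k⊕k'≡⊕m i = trans (⊕-assoc i k k') (cong (i ⊕_) k+k'≡m)

  ⊕k⊕m⊕k'≡id : (i : Fin n) → ((i ⊕ k) ⊕ m) ⊕ k' ≡ i
  ⊕k⊕m⊕k'≡id i = begin
    ((i ⊕ k) ⊕ m) ⊕ k' ≡⟨ ⊕-comm (i ⊕ k) m k' ⟩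
    ((i ⊕ k) ⊕ k') ⊕ m ≡⟨ cong (_⊕ m) (⊕k⊕k'≡⊕m i) ⟩
    (i ⊕ m) ⊕ m        ≡⟨ ⊕m⊕m≡id i ⟩
    i                  ∎
    where open ≡-Reasoning

  halfTurn-edge : ∀ {a b} → Edge n k a b → Adj n k' (halfTurn a) (halfTurn b)
  halfTurn-edge (uu i) = inj₁ (uu i)
  halfTurn-edge (uw i) = inj₁ (uw i)
  halfTurn-edge (xy i) = inj₁ (xy (i ⊕ m))
  halfTurn-edge (xx i) =
    inj₁ (subst (λ j → Edge n k' (X , i ⊕ m) (X , j)) (⊕-comm i m 1) (xx (i ⊕ m)))
  halfTurn-edge (wy i) =
    inj₂ (subst (λ j → Edge n k' (Y , (i ⊕ k) ⊕ m) (W , j)) (⊕k⊕m⊕k'≡id i) (yw ((i ⊕ k) ⊕ m)))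
  halfTurn-edge (yw i) =
    inj₂ (subst (λ j → Edge n k' (W , i ⊕ k) (Y , j)) (⊕k⊕k'≡⊕m i) (wy (i ⊕ k)))

  halfTurn-adj : ∀ {a b} → Adj n k a b → Adj n k' (halfTurn a) (halfTurn b)
  halfTurn-adj (inj₁ e) = halfTurn-edge e
  halfTurn-adj (inj₂ e) = swap (halfTurn-edge e)

halfTurnIso : ∀ {n} .{{_ : NonZero n}} (m k k' : ℕ) → n ≡ m + m → k + k' ≡ m → DPIso n k k'
halfTurnIso {n} m k k' n≡m+m k+k'≡m = record
  { φ = ↔⇒⤖ (mk↔ₛ′ halfTurn halfTurn halfTurn-involutive halfTurn-involutive)
  ; preserves = λ a b → mk⇔ halfTurn-adj λ adj →
      subst₂ (Adj n k) (halfTurn-involutive a) (halfTurn-involutive b) (Back.halfTurn-adj adj)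
  }
  where
  open HalfTurn m k k' n≡m+m k+k'≡m
  module Back = HalfTurn m k' k n≡m+m (trans (+-comm k' k) k+k'≡m)

theorem3 : (n k : ℕ) → .{{_ : NonZero n}} → 2 ∣ n → 1 ≤ k → 2 * k < n →
    DPIso n k (n / 2 ∸ k)
theorem3 .(m * 2) k (divides-refl m) _ 2k<2m =
  subst (λ h → DPIso (m * 2) k (h ∸ k)) (sym (m*n/n≡m m 2))
    (halfTurnIso m k (m ∸ k) m*2≡m+m (m+[n∸m]≡n k≤m))
  where
  m*2≡m+m : m * 2 ≡ m + m
  m*2≡m+m = trans (*-comm m 2) (cong (m +_) (+-identityʳ m))

  k≤m : k ≤ m
  k≤m = <⇒≤ (*-cancelˡ-< 2 k m (subst (2 * k <_) (*-comm m 2) 2k<2m))
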